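{- Let $k\geq 1$ and let $(G,L)$ be a reduced instance of $\textsc{LHom}(C_{2k+1})$. Let $u,w\in V(G)$ with $L(u)=\{i\}$ and $L(w)=\{i+1\}$, and let $v\in V(G)$ satisfy $\mathrm{dist}_G(u,v)=\mathrm{dist}_G(w,v)=k+\ell$ for some integer $\ell\geq 0$. Then $L(v)\subseteq\{i+k-\ell+1,\,i+k-\ell+2,\,\ldots,\,i+k+\ell+1\}$ (arithmetic modulo $2k+1$).
   Context: All graphs are finite and simple. $C_{2k+1}$ has vertex set $\{0,1,\ldots,2k\}$ with $i$ adjacent to $i\pm1$, arithmetic modulo $2k+1$. An instance of $\textsc{LHom}(H)$ is a graph $G$ with lists $L:V(G)\to 2^{V(H)}$ (asking for $\varphi:V(G)\to V(H)$, $\varphi(v)\in L(v)$, preserving edges). Identifying vertices means replacing them by a single vertex adjacent to the union of their neighbourhoods. An instance is reduced if applying any of the following rules neither returns NO nor changes the instance: (R1) If $H=C_{2k+1}$ and $G$ contains an odd cycle of length at most $2k-1$, return NO. (R2) If $H=C_{2k+1}$ and $G$ contains two $(2k+1)$-cycles with consecutive vertices $c_0,\ldots,c_{2k}$ and $c'_0,\ldots,c'_{2k}$ with $c_0=c'_0$ and $c_i=c'_j$ for some $i,j\neq0$: if $i=j$ identify $c_\ell$ with $c'_\ell$ for all $\ell$; if $i=-j$ identify $c_\ell$ with $c'_{ -\ell}$ for all $\ell$; otherwise return NO. (R3) For every edge $uv$, if $x\in L(u)$ has $N_H(x)\cap L(v)=\emptyset$, remove $x$ from $L(u)$. (R4)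 If some list is empty, return NO. (R5) For $v\in V(G)$, if distinct $x,y\in L(v)$ satisfy $N_H(x)\cap L(w)\subseteq N_H(y)\cap L(w)$ for all $w\in N_G(v)$, remove $x$ from $L(v)$. (R6) If distinct $u,v$ have $L(u)=L(v)=\{x\}$: if $uv\in E(G)$ return NO, else identify $u$ and $v$. -}

module Defs where

open import Data.Nat using (ℕ; zero; suc; _+_; _*_; _≤_; _<_; _%_)
open import Data.Nat.DivMod using (_mod_)
open import Data.Fin using (Fin; zero; suc; toℕ; opposite)
open import Data.Fin.Subset using (Subset; _∈_; ⁅_⁆)
open import Data.Bool using (Bool; true; false)
open import Data.Product using (Σ; ∃; _×_; _,_)
open import Data.Sum using (_⊎_)
open import Relation.Nullary using (¬_)
open import Relation.Binary.PropositionalEquality using (_≡_; _≢_)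

cyc : ℕ → ℕ
cyc k = suc (2 * k)

addC : ∀ {k} → Fin (cyc k) → ℕ → Fin (cyc k)
addC {k} x t = (toℕ x + t) mod (cyc k)

-- additive inverse modulo m (for Fin (suc n)): -0 = 0, -(j+1) = n - j
negF : ∀ {n} → Fin (suc n) → Fin (suc n)
negF zero    = zero
negF (suc x) = suc (opposite x)

AdjC : ∀ {k} → Fin (cyc k) → Fin (cyc k) → Set
AdjC {k} x y = (y ≡ addC {k} x 1) ⊎ (x ≡ addC {k} y 1)

record Graph : Set where
  field
    n     : ℕ
    adj   : Fin n → Fin n → Bool
    sym   : ∀ u v → adj u v ≡ adj v u
    irref : ∀ v → adj v v ≡ false

module _ (G : Graph) where
  open Graph G

  Edge : Fin n → Fin n → Set
  Edge u v = adj u v ≡ true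

  data Walk : Fin n → Fin n → ℕ → Set where
    nil  : ∀ {u} → Walk u u 0
    cons : ∀ {u v w d} → Edge u v → Walk v w d → Walk u w (suc d)

  Dist : Fin n → Fin n → ℕ → Set
  Dist u v d = Walk u v d × (∀ m → Walk u v m → d ≤ m)

  CycSucc : (p : ℕ) → Fin p → Fin p → Set
  CycSucc p a b = (toℕ b ≡ suc (toℕ a)) ⊎ ((suc (toℕ a) ≡ p) × (toℕ b ≡ 0))

  IsCycle : (p : ℕ) → (Fin p → Fin n) → Set
  IsCycle p c =
    (3 ≤ p) ×
    (∀ a b → c a ≡ c b → a ≡ b) ×
    (∀ a b → CycSucc p a b → Edge (c a) (c b))

Odd : ℕ → Set
Odd p = ∃ λ q → p ≡ suc (q + q)

-- Reduced instances of LHom(C_{2k+1}); lists are subsets of V(C_{2k+1}).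
-- Each field says that the corresponding rule neither returns NO nor
-- changes the instance.

record Reduced (k : ℕ) (G : Graph) (L : Fin (Graph.n G) → Subset (cyc k)) : Set where
  open Graph G
  field
    R1 : ∀ p (c : Fin p → Fin n) → Odd p → suc p ≤ 2 * k → ¬ IsCycle G p c
    -- (R2) applying R2 to any pair of (2k+1)-cycles is a no-op
    R2 : ∀ (c c' : Fin (cyc k) → Fin n) → IsCycle G (cyc k) c → IsCycle G (cyc k) c' →
         c zero ≡ c' zero → ∀ i j → i ≢ zero → j ≢ zero → c i ≡ c' j →
         ((i ≡ j) × (∀ l → c l ≡ c' l)) ⊎ ((i ≡ negF j) × (∀ l → c l ≡ c' (negF l)))
    R3 : ∀ u v → Edge G u v → ∀ x → x ∈ L u → ∃ λ y → y ∈ L v × AdjC {k} x y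
    R4 : ∀ v → ∃ λ x → x ∈ L v
    R5 : ∀ v x y → x ≢ y → x ∈ L v → y ∈ L v →
         ¬ (∀ w → Edge G v w → ∀ z → z ∈ L w → AdjC {k} x z → AdjC {k} y z)
    R6 : ∀ u v x → L u ≡ ⁅ x ⁆ → L v ≡ ⁅ x ⁆ → u ≡ v

{-# OPTIONS --safe #-}
-- Arc consistency (R3) lets a walk of length d in G that ends at v be followed backwards in
-- C_{2k+1}: from any colour x ∈ L(v) it leads to a colour y in the list of its start along a
-- walk of length d, and if b steps of that walk go down then x + 2b ≡ y + d (mod 2k+1).
-- Doing this from u and from w gives x + 2b ≡ i + k + ℓ and x + 2b' ≡ i + 1 + k + ℓ, so b and
-- b' differ by some e with 2e + 1 ≡ 0 or 2e ≡ 1, i.e. by at least k or k + 1. Since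
-- b, b' ≤ k + ℓ, the smaller one is at most ℓ, which puts x + ℓ at most 2ℓ steps above
-- i + k + 1.

module Submission where

open import Defs
open import Data.Nat using (ℕ; suc; _+_; _≤_; _%_)
open import Data.Fin using (Fin; toℕ)
open import Data.Fin.Subset using (Subset; _∈_; ⁅_⁆)
open import Data.Product using (∃; _×_)
open import Relation.Binary.PropositionalEquality using (_≡_)

open import Data.Nat using (_*_; _<_; _<?_; s≤s; s≤s⁻¹; z≤n)
open import Data.Nat.DivMod using (m%n%n≡m%n; [m+kn]%n≡m%n; %-distribˡ-+; m<n⇒m%n≡m)
open import Data.Nat.Properties
open import Data.Nat.Tactic.RingSolver using (solve-∀)
open import Algebra.Properties.CommutativeSemigroup +-commutativeSemigroup using (xy∙z≈xz∙y)
open import Data.Fin.Properties using (toℕ-fromℕ<)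
open import Data.Fin.Subset.Properties using (x∈⁅y⁆⇒x≡y)
open import Data.Product using (_,_)
open import Data.Sum using (_⊎_; inj₁; inj₂)
open import Level using (0ℓ)
open import Relation.Binary.Bundles using (Setoid)
open import Relation.Binary.PropositionalEquality using (refl; sym; trans; cong; subst)
open import Relation.Nullary using (yes; no; contradiction)

module Congruence (n : ℕ) where

  infix 4 _≋_
  record _≋_ (a b : ℕ) : Set where
    constructor mk≋
    field %-≡ : a % suc n ≡ b % suc n
  open _≋_ public

  ≋-setoid : Setoid 0ℓ 0ℓ
  ≋-setoid = record
    { Carrier       = ℕ
    ; _≈_           = _≋_
    ; isEquivalence = record
      { refl  = mk≋ refl
      ; sym   = λ (mk≋ p) → mk≋ (sym p)
      ; trans = λ (mk≋ p) (mk≋ q) → mk≋ (trans p q)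
      }
    }

  open Setoid ≋-setoid public using () renaming (sym to ≋-sym; trans to ≋-trans)

  ≡⇒≋ : ∀ {a b} → a ≡ b → a ≋ b
  ≡⇒≋ p = mk≋ (cong (_% suc n) p)

  %-≋ : ∀ a → a % suc n ≋ a
  %-≋ a = mk≋ (m%n%n≡m%n a (suc n))

  +-congʳ-≋ : ∀ {a b} c → a ≋ b → a + c ≋ b + c
  +-congʳ-≋ {a} {b} c (mk≋ p) = mk≋ (begin
    (a + c) % suc n                    ≡⟨ %-distribˡ-+ a c (suc n) ⟩
    (a % suc n + c % suc n) % suc n    ≡⟨ cong (λ r → (r + c % suc n) % suc n) p ⟩
    (b % suc n + c % suc n) % suc n    ≡⟨ %-distribˡ-+ b c (suc n) ⟨
    (b + c) % suc n                    ∎)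
    where open Relation.Binary.PropositionalEquality.≡-Reasoning

  -- Adding c * n to both sides completes c to a multiple c * (n + 1) of the modulus.
  +-cancelˡ-≋ : ∀ {a b} c → c + a ≋ c + b → a ≋ b
  +-cancelˡ-≋ {a} {b} c h = begin
    a                ≈⟨ mk≋ ([m+kn]%n≡m%n a c (suc n)) ⟨
    a + c * suc n    ≡⟨ regroup n a c ⟩
    c + a + c * n    ≈⟨ +-congʳ-≋ (c * n) h ⟩
    c + b + c * n    ≡⟨ regroup n b c ⟨
    b + c * suc n    ≈⟨ mk≋ ([m+kn]%n≡m%n b c (suc n)) ⟩
    b                ∎
    where
    open import Relation.Binary.Reasoning.Setoid ≋-setoid
    regroup : ∀ m a c → a + c * suc m ≡ c + a + c * m
    regroup = solve-∀

β+e≤k+ℓ⇒∃[c]β+[δ+c]≡ℓ : ∀ β δ {e k ℓ} → β + e ≤ k + ℓ → δ + k ≤ e →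
                        ∃ λ c → β + (δ + c) ≡ ℓ
β+e≤k+ℓ⇒∃[c]β+[δ+c]≡ℓ β δ {e} {k} {ℓ} β+e≤k+ℓ δ+k≤e =
  let c , β+δ+c≡ℓ = m≤n⇒∃[o]m+o≡n β+δ≤ℓ
  in  c , trans (sym (+-assoc β δ c)) β+δ+c≡ℓ
  where
  open ≤-Reasoning
  β+δ≤ℓ : β + δ ≤ ℓ
  β+δ≤ℓ = +-cancelˡ-≤ k (β + δ) ℓ (begin
    k + (β + δ)  ≡⟨ +-comm k (β + δ) ⟩
    β + δ + k    ≡⟨ +-assoc β δ k ⟩
    β + (δ + k)  ≤⟨ +-monoʳ-≤ β δ+k≤e ⟩
    β + e        ≤⟨ β+e≤k+ℓ ⟩
    k + ℓ        ∎)

module OddCycle (k : ℕ) where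

  open Congruence (2 * k) public
  open import Relation.Binary.Reasoning.Setoid ≋-setoid

  toℕ-addC-≋ : ∀ (y : Fin (cyc k)) t → toℕ (addC {k} y t) ≋ toℕ y + t
  toℕ-addC-≋ y t = begin
    toℕ (addC {k} y t)     ≡⟨ toℕ-fromℕ< _ ⟩
    (toℕ y + t) % cyc k    ≈⟨ %-≋ (toℕ y + t) ⟩
    toℕ y + t              ∎

  1+2*e≋0⇒k≤e : ∀ e → 1 + 2 * e ≋ 0 → k ≤ e
  1+2*e≋0⇒k≤e e (mk≋ p) with 1 + 2 * e <? cyc k
  ... | yes small = contradiction (trans (sym (m<n⇒m%n≡m small)) p) λ ()
  ... | no  large = *-cancelˡ-≤ 2 (s≤s⁻¹ (≮⇒≥ large))

  2*e≋1⇒k<e : 1 ≤ k → ∀ e → 2 * e ≋ 1 → k < e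
  2*e≋1⇒k<e 1≤k e (mk≋ p) with 2 * e <? cyc k
  ... | yes small = contradiction (m*n≡1⇒m≡1 2 e 2*e≡1) λ ()
    where
    1<cyc : 1 < cyc k
    1<cyc = s≤s (≤-trans 1≤k (m≤m+n k (k + 0)))
    2*e≡1 : 2 * e ≡ 1
    2*e≡1 = trans (sym (m<n⇒m%n≡m small)) (trans p (m<n⇒m%n≡m 1<cyc))
  ... | no  large = *-cancelˡ-< 2 k e (≮⇒≥ large)

  -- A walk of length d from y to x in C_{2k+1}, recorded by its number b of steps of -1
  -- (the other d - b steps are +1, whence x + 2b ≡ y + d).
  CycleWalk : Fin (cyc k) → Fin (cyc k) → ℕ → Set
  CycleWalk y x d = ∃ λ b → b ≤ d × toℕ x + 2 * b ≋ toℕ y + d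

  cycleWalk-refl : ∀ x → CycleWalk x x 0
  cycleWalk-refl x = 0 , z≤n , mk≋ refl

  cycleWalk-step : ∀ {y z x d} → AdjC {k} y z → CycleWalk y x d → CycleWalk z x (suc d)
  cycleWalk-step {y} {z} {x} {d} (inj₁ z≡y+1) (b , b≤d , h) = suc b , s≤s b≤d , (begin
    toℕ x + 2 * suc b          ≡⟨ two-more (toℕ x) b ⟩
    toℕ x + 2 * b + 2          ≈⟨ +-congʳ-≋ 2 h ⟩
    toℕ y + d + 2              ≡⟨ one-more (toℕ y) d ⟩
    toℕ y + 1 + suc d          ≈⟨ +-congʳ-≋ (suc d) (toℕ-addC-≋ y 1) ⟨
    toℕ (addC {k} y 1) + suc d ≡⟨ cong (λ r → toℕ r + suc d) z≡y+1 ⟨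
    toℕ z + suc d              ∎)
    where
    two-more : ∀ a b → a + 2 * suc b ≡ a + 2 * b + 2
    two-more = solve-∀
    one-more : ∀ a d → a + d + 2 ≡ a + 1 + suc d
    one-more = solve-∀
  cycleWalk-step {y} {z} {x} {d} (inj₂ y≡z+1) (b , b≤d , h) = b , m≤n⇒m≤1+n b≤d , (begin
    toℕ x + 2 * b              ≈⟨ h ⟩
    toℕ y + d                  ≡⟨ cong (λ r → toℕ r + d) y≡z+1 ⟩
    toℕ (addC {k} z 1) + d     ≈⟨ +-congʳ-≋ d (toℕ-addC-≋ z 1) ⟩
    toℕ z + 1 + d              ≡⟨ +-assoc (toℕ z) 1 d ⟩
    toℕ z + suc d              ∎)

  recentre : ∀ x j β c → x + 2 * β ≋ j + (k + (β + c)) → x + (β + c) ≋ j + k + (c + c)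
  recentre x j β c h = +-cancelˡ-≋ β (begin
    β + (x + (β + c))      ≡⟨ regroupˡ x β c ⟩
    x + 2 * β + c          ≈⟨ +-congʳ-≋ c h ⟩
    j + (k + (β + c)) + c  ≡⟨ regroupʳ j k β c ⟩
    β + (j + k + (c + c))  ∎)
    where
    regroupˡ : ∀ x β c → β + (x + (β + c)) ≡ x + 2 * β + c
    regroupˡ = solve-∀
    regroupʳ : ∀ j k β c → j + (k + (β + c)) + c ≡ β + (j + k + (c + c))
    regroupʳ = solve-∀

  backstep-gap : 1 ≤ k → ∀ X J K b b' → X + 2 * b ≋ J + K → X + 2 * b' ≋ J + 1 + K →
                 (∃ λ e → b ≡ b' + e × k ≤ e) ⊎ (∃ λ e → b' ≡ b + e × k < e)
  backstep-gap 1≤k X J K b b' h h' with ≤-total b' b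
  ... | inj₁ b'≤b with m≤n⇒∃[o]m+o≡n b'≤b
  ...   | e , refl = inj₁ (e , refl , 1+2*e≋0⇒k≤e e (+-cancelˡ-≋ (X + 2 * b') (begin
    X + 2 * b' + (1 + 2 * e)  ≡⟨ regroup-odd X b' e ⟩
    X + 2 * (b' + e) + 1      ≈⟨ +-congʳ-≋ 1 h ⟩
    J + K + 1                 ≡⟨ xy∙z≈xz∙y J K 1 ⟩
    J + 1 + K                 ≈⟨ h' ⟨
    X + 2 * b'                ≡⟨ +-identityʳ (X + 2 * b') ⟨
    X + 2 * b' + 0            ∎)))
    where
    regroup-odd : ∀ X b e → X + 2 * b + (1 + 2 * e) ≡ X + 2 * (b + e) + 1
    regroup-odd = solve-∀
  backstep-gap 1≤k X J K b b' h h' | inj₂ b≤b' with m≤n⇒∃[o]m+o≡n b≤b'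
  ...   | e , refl = inj₂ (e , refl , 2*e≋1⇒k<e 1≤k e (+-cancelˡ-≋ (X + 2 * b) (begin
    X + 2 * b + 2 * e         ≡⟨ regroup-even X b e ⟩
    X + 2 * (b + e)           ≈⟨ h' ⟩
    J + 1 + K                 ≡⟨ xy∙z≈xz∙y J K 1 ⟨
    J + K + 1                 ≈⟨ +-congʳ-≋ 1 h ⟨
    X + 2 * b + 1             ∎)))
    where
    regroup-even : ∀ X b e → X + 2 * b + 2 * e ≡ X + 2 * (b + e)
    regroup-even = solve-∀

  backsteps-window : 1 ≤ k → ∀ X I ℓ b b' → b ≤ k + ℓ → b' ≤ k + ℓ →
                     X + 2 * b ≋ I + (k + ℓ) → X + 2 * b' ≋ I + 1 + (k + ℓ) →
                     ∃ λ t → t ≤ ℓ + ℓ × X + ℓ ≋ I + k + 1 + t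
  backsteps-window 1≤k X I ℓ b b' b≤ b'≤ h h' with backstep-gap 1≤k X I (k + ℓ) b b' h h'
  ... | inj₁ (e , refl , k≤e) with β+e≤k+ℓ⇒∃[c]β+[δ+c]≡ℓ b' 0 b≤ k≤e
  ...   | c , refl = c + c , +-mono-≤ c≤ℓ c≤ℓ ,
    ≋-trans (recentre X (I + 1) b' c h') (≡⇒≋ (cong (_+ (c + c)) (xy∙z≈xz∙y I 1 k)))
    where
    c≤ℓ : c ≤ b' + c
    c≤ℓ = m≤n+m c b'
  backsteps-window 1≤k X I ℓ b b' b≤ b'≤ h h' | inj₂ (e , refl , k<e)
    with β+e≤k+ℓ⇒∃[c]β+[δ+c]≡ℓ b 1 b'≤ k<e
  ...   | c , refl = c + suc c , +-mono-≤ (≤-trans (n≤1+n c) 1+c≤ℓ) 1+c≤ℓ ,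
    ≋-trans (recentre X I b (suc c) h) (≡⇒≋ (sym (+-assoc (I + k) 1 (c + suc c))))
    where
    1+c≤ℓ : suc c ≤ b + suc c
    1+c≤ℓ = m≤n+m (suc c) b

  adjacent-cycleWalks-window : 1 ≤ k → ∀ i x ℓ →
                               CycleWalk i x (k + ℓ) → CycleWalk (addC {k} i 1) x (k + ℓ) →
                               ∃ λ t → t ≤ ℓ + ℓ × toℕ x + ℓ ≋ toℕ i + k + 1 + t
  adjacent-cycleWalks-window 1≤k i x ℓ (b , b≤ , h) (b' , b'≤ , h') =
    backsteps-window 1≤k (toℕ x) (toℕ i) ℓ b b' b≤ b'≤ h
      (≋-trans h' (+-congʳ-≋ (k + ℓ) (toℕ-addC-≋ i 1)))

ArcConsistent : (k : ℕ) (G : Graph) → (Fin (Graph.n G) → Subset (cyc k)) → Set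
ArcConsistent k G L = ∀ u v → Edge G u v → ∀ x → x ∈ L u → ∃ λ y → y ∈ L v × AdjC {k} x y

module _ (k : ℕ) {G : Graph} {L : Fin (Graph.n G) → Subset (cyc k)}
         (arc : ArcConsistent k G L) where

  open OddCycle k using (CycleWalk; cycleWalk-refl; cycleWalk-step)

  walk-lift : ∀ {a c d x} → Walk G a c d → x ∈ L c → ∃ λ y → y ∈ L a × CycleWalk y x d
  walk-lift {x = x} nil x∈Lc = x , x∈Lc , cycleWalk-refl x
  walk-lift {x = x} (cons {u = a} {v = a'} a~a' w) x∈Lc =
    let y , y∈La' , y⇝x = walk-lift w x∈Lc
        z , z∈La , y~z  = arc a' a (trans (Graph.sym G a' a) a~a') y y∈La'
    in  z , z∈La , cycleWalk-step {x = x} y~z y⇝x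

  walk-lift-singleton : ∀ {a c d x y} →
                        L a ≡ ⁅ y ⁆ → Walk G a c d → x ∈ L c → CycleWalk y x d
  walk-lift-singleton {d = d} {x} {y} La≡⁅y⁆ w x∈Lc =
    let y' , y'∈La , y'⇝x = walk-lift w x∈Lc
    in  subst (λ s → CycleWalk s x d) (x∈⁅y⁆⇒x≡y y (subst (y' ∈_) La≡⁅y⁆ y'∈La)) y'⇝x

lemma4 : (k : ℕ) → 1 ≤ k →
    (G : Graph) → (L : Fin (Graph.n G) → Subset (cyc k)) → Reduced k G L →
    (u w v : Fin (Graph.n G)) → (i : Fin (cyc k)) →
    L u ≡ ⁅ i ⁆ → L w ≡ ⁅ addC {k} i 1 ⁆ →
    (ℓ : ℕ) → Dist G u v (k + ℓ) → Dist G w v (k + ℓ) →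
    ∀ x → x ∈ L v →
    ∃ λ t → (t ≤ ℓ + ℓ) × ((toℕ x + ℓ) % cyc k ≡ (toℕ i + k + 1 + t) % cyc k)
lemma4 k 1≤k G L reduced u w v i Lu≡⁅i⁆ Lw≡⁅i+1⁆ ℓ (u⇝v , _) (w⇝v , _) x x∈Lv =
  let t , t≤ℓ+ℓ , x+ℓ≋i+k+1+t = adjacent-cycleWalks-window 1≤k i x ℓ
                                   (walk-lift-singleton k R3 Lu≡⁅i⁆ u⇝v x∈Lv)
                                   (walk-lift-singleton k R3 Lw≡⁅i+1⁆ w⇝v x∈Lv)
  in  t , t≤ℓ+ℓ , %-≡ x+ℓ≋i+k+1+t
  where
  open OddCycle k
  open Reduced reduced using (R3)
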